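{- Let $k$ and $l$ be positive integers with $l \le k$ and $l \mid k$, and let $k' = \frac{2^{l}}{l}k$. Let $X_1, \ldots, X_l$ be sequences $X_j = x_{j,1}, \ldots, x_{j,k'}$ of length $k'$, with indices of $x_{j,\cdot}$ read cyclically modulo $k'$ (in $\{1,\ldots,k'\}$). Let $s \in \{\text{red}, \text{blue}\}$ and let $c$ be a red/blue coloring of the elements such that for every $j = 1, \ldots, l$, at least $\frac{k'}{2}$ of $x_{j,1}, \ldots, x_{j,k'}$ have color $s$ under $c$. Then there exist $i_1, \ldots, i_l \in \{0, 1, \ldots, k'-1\}$ such that for at least $\frac{k}{l}$ distinct values $r \in \{1, \ldots, k'\}$, the elements $x_{1, r + i_{1}}, x_{2, r + i_{2}}, \ldots, x_{l, r + i_{l}}$ all have color $s$ under $c$.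
   Context: Indices are cyclic: $x_{j, r+i}$ means $x_{j, t}$ where $t \in \{1,\ldots,k'\}$ and $t \equiv r+i \pmod{k'}$. -}

module Defs where

open import Data.Nat using (ℕ; zero; suc; _+_; _*_; _^_; _/_; NonZero)
open import Data.Nat.DivMod using (_mod_)
open import Data.Fin using (Fin; toℕ)
open import Data.Bool using (Bool; true; false; if_then_else_)
open import Relation.Binary.PropositionalEquality using (_≡_; refl)
open import Relation.Nullary using (Dec; yes; no)
open import Relation.Nullary.Decidable using (⌊_⌋)

data Colour : Set where
  red blue : Colour

_≟ᶜ_ : (a b : Colour) → Dec (a ≡ b)
red  ≟ᶜ red  = yes refl
red  ≟ᶜ blue = no (λ ())
blue ≟ᶜ red  = no (λ ())
blue ≟ᶜ blue = yes refl

count : (n : ℕ) → (Fin n → Bool) → ℕ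
count zero    p = 0
count (suc n) p = (if p Fin.zero then 1 else 0) + count n (λ t → p (Fin.suc t))
  where import Data.Fin as Fin

-- Cyclic index: position r shifted by i, read modulo n (0-based positions).
cyc : (n : ℕ) → Fin n → ℕ → Fin n
cyc (suc m) r i = (toℕ r + i) mod suc m

-- k' = (2^l / l) * k, written as 2^l * (k / l) (exact since l ∣ k).
k′ : (k l : ℕ) → .{{_ : NonZero l}} → ℕ
k′ k l = 2 ^ l * (k / l)

-- Given shifts under which the first t sequences are
-- simultaneously good at a set S of positions, double counting shows that, summed over all n
-- shifts i of the next sequence, the positions r ∈ S where that sequence is also good at r + i
-- number |S| · |good| ≥ |S| · n / 2. Hence some shift keeps at least half of S, and each of the
-- l sequences costs a factor 2, giving n / 2^l = k / l common good positions.
module Submission where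

open import Defs
open import Data.Nat.Properties
open import Algebra.Properties.Semiring.Sum +-*-semiring
  using (sum; sum-syntax; sum-cong-≗; sum-init-last; ∑-comm; *-distribˡ-sum; *-distribʳ-sum)
open import Data.Bool using (Bool; true; false; _∧_; if_then_else_)
open import Data.Fin using (Fin; toℕ; zero; suc; inject₁; fromℕ)
open import Data.Fin.Properties
  using (all?; any?; toℕ<n; toℕ-inject₁; toℕ-fromℕ; fromℕ<-cong; fromℕ<-toℕ)
open import Data.Nat using (ℕ; _+_; _*_; _^_; _≤_; _<_; _>_; _/_; _≤?_; z≤n; NonZero)
open import Data.Nat.Divisibility using (_∣_)
open import Data.Nat.DivMod using (_mod_; [m+n]%n≡m%n; m<n⇒m%n≡m; m≥n⇒m/n>0)
open import Data.Product using (∃; _,_)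
open import Data.Vec.Functional using (Vector; _∷_)
open import Function using (_∘_)
open import Relation.Binary.PropositionalEquality
  using (_≡_; _≗_; refl; sym; trans; cong; cong₂; module ≡-Reasoning)
open import Relation.Nullary using (yes; no; contradiction)
open import Relation.Nullary.Decidable using (⌊_⌋; isYes≗does)
open import Relation.Unary using (Decidable)

indicator : Bool → ℕ
indicator b = if b then 1 else 0

indicator-∧ : ∀ a b → indicator (a ∧ b) ≡ indicator a * indicator b
indicator-∧ true  b = sym (+-identityʳ (indicator b))
indicator-∧ false b = refl

count-as-sum : ∀ n (p : Fin n → Bool) → count n p ≡ ∑[ t < n ] indicator (p t)
count-as-sum ℕ.zero    p = refl
count-as-sum (ℕ.suc n) p = cong (indicator (p zero) +_) (count-as-sum n (p ∘ suc))

count-cong : ∀ n {p q : Fin n → Bool} → p ≗ q → count n p ≡ count n q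
count-cong n {p} {q} p≗q = begin
  count n p                   ≡⟨ count-as-sum n p ⟩
  ∑[ t < n ] indicator (p t)  ≡⟨ sum-cong-≗ {n} (cong indicator ∘ p≗q) ⟩
  ∑[ t < n ] indicator (q t)  ≡⟨ count-as-sum n q ⟨
  count n q                   ∎
  where open ≡-Reasoning

count-true : ∀ n → count n (λ _ → true) ≡ n
count-true ℕ.zero    = refl
count-true (ℕ.suc n) = cong ℕ.suc (count-true n)

mod-periodic : ∀ a n .{{_ : NonZero n}} → (a + n) mod n ≡ a mod n
mod-periodic a n = fromℕ<-cong _ _ ([m+n]%n≡m%n a n) _ _

toℕ-mod : ∀ {n} .{{_ : NonZero n}} (i : Fin n) → toℕ i mod n ≡ i
toℕ-mod i = trans (fromℕ<-cong _ _ (m<n⇒m%n≡m (toℕ<n i)) _ (toℕ<n i)) (fromℕ<-toℕ i _)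

∑-shift-periodic : ∀ n (h : ℕ → ℕ) → (∀ a → h (a + n) ≡ h a) →
  ∀ r → ∑[ i < n ] h (r + toℕ i) ≡ ∑[ i < n ] h (toℕ i)
∑-shift-periodic n h periodic ℕ.zero    = refl
∑-shift-periodic n h periodic (ℕ.suc r) =
  trans shift-by-one (∑-shift-periodic n h periodic r)
  where
  open ≡-Reasoning
  window : Vector ℕ (ℕ.suc n)
  window j = h (r + toℕ j)
  -- The window r, …, r + n has equal ends, so dropping either end leaves the same sum.
  shift-by-one : ∑[ i < n ] h (ℕ.suc r + toℕ i) ≡ ∑[ i < n ] h (r + toℕ i)
  shift-by-one = +-cancelʳ-≡ (h r) _ _ (begin
    ∑[ i < n ] h (ℕ.suc r + toℕ i) + h r
      ≡⟨ cong₂ _+_ (sum-cong-≗ {n} (λ i → cong h (sym (+-suc r (toℕ i)))))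
                   (cong h (sym (+-identityʳ r))) ⟩
    ∑[ i < n ] window (suc i) + window zero
      ≡⟨ +-comm _ (window zero) ⟩
    sum window
      ≡⟨ sum-init-last window ⟩
    ∑[ i < n ] window (inject₁ i) + window (fromℕ n)
      ≡⟨ cong₂ _+_ (sum-cong-≗ {n} (λ i → cong (λ a → h (r + a)) (toℕ-inject₁ i)))
                   (trans (cong (λ a → h (r + a)) (toℕ-fromℕ n)) (periodic r)) ⟩
    ∑[ i < n ] h (r + toℕ i) + h r ∎)

∑-indicator-cyc : ∀ n (r : Fin n) (g : Fin n → Bool) →
  ∑[ i < n ] indicator (g (cyc n r (toℕ i))) ≡ count n g
∑-indicator-cyc n@(ℕ.suc _) r g = begin
  ∑[ i < n ] h (toℕ r + toℕ i)  ≡⟨ ∑-shift-periodic n h (λ a → cong (indicator ∘ g) (mod-periodic a n)) (toℕ r) ⟩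
  ∑[ i < n ] h (toℕ i)          ≡⟨ sum-cong-≗ {n} (cong (indicator ∘ g) ∘ toℕ-mod) ⟩
  ∑[ i < n ] indicator (g i)    ≡⟨ count-as-sum n g ⟨
  count n g                     ∎
  where
  open ≡-Reasoning
  h : ℕ → ℕ
  h a = indicator (g (a mod n))

∑-count-shifted : ∀ n (g S : Fin n → Bool) →
  ∑[ i < n ] count n (λ r → g (cyc n r (toℕ i)) ∧ S r) ≡ count n g * count n S
∑-count-shifted n g S = begin
  ∑[ i < n ] count n (λ r → g (cyc n r (toℕ i)) ∧ S r)
    ≡⟨ sum-cong-≗ {n} (λ i → trans (count-as-sum n _) (sum-cong-≗ {n} (λ r → indicator-∧ _ (S r)))) ⟩
  ∑[ i < n ] ∑[ r < n ] (indicator (g (cyc n r (toℕ i))) * indicator (S r))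
    ≡⟨ ∑-comm {n} {n} _ ⟩
  ∑[ r < n ] ∑[ i < n ] (indicator (g (cyc n r (toℕ i))) * indicator (S r))
    ≡⟨ sum-cong-≗ {n} (λ r → sym (*-distribʳ-sum {n} (indicator (S r)) _)) ⟩
  ∑[ r < n ] ((∑[ i < n ] indicator (g (cyc n r (toℕ i)))) * indicator (S r))
    ≡⟨ sum-cong-≗ {n} (λ r → cong (_* indicator (S r)) (∑-indicator-cyc n r g)) ⟩
  ∑[ r < n ] (count n g * indicator (S r))
    ≡⟨ *-distribˡ-sum {n} (count n g) _ ⟨
  count n g * ∑[ r < n ] indicator (S r)
    ≡⟨ cong (count n g *_) (count-as-sum n S) ⟨
  count n g * count n S ∎
  where open ≡-Reasoning

∑-≤-* : ∀ {n} (f : Vector ℕ n) {m} → (∀ i → f i ≤ m) → sum f ≤ n * m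
∑-≤-* {ℕ.zero}  f f≤m = z≤n
∑-≤-* {ℕ.suc n} f f≤m = +-mono-≤ (f≤m zero) (∑-≤-* (f ∘ suc) (f≤m ∘ suc))

∑-<-* : ∀ {n} (f : Vector ℕ n) {m} → 0 < n → (∀ i → f i < m) → sum f < n * m
∑-<-* {ℕ.suc n} f _ f<m = +-mono-<-≤ (f<m zero) (∑-≤-* (f ∘ suc) (<⇒≤ ∘ f<m ∘ suc))

∃-≥-average : ∀ {n} (f : Vector ℕ n) {m} → 0 < n → n * m ≤ sum f → ∃ λ i → m ≤ f i
∃-≥-average f {m} n>0 n*m≤∑f with any? (λ i → m ≤? f i)
... | yes found = found
... | no ¬found = contradiction n*m≤∑f (<⇒≱ (∑-<-* f n>0 (λ i → ≰⇒> (λ m≤fi → ¬found (i , m≤fi)))))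

∃-shift-keeping-half : ∀ {n} → 0 < n → (g S : Fin n → Bool) → n ≤ 2 * count n g →
  ∃ λ i → count n S ≤ 2 * count n (λ r → g (cyc n r (toℕ i)) ∧ S r)
∃-shift-keeping-half {n} n>0 g S half = ∃-≥-average _ n>0 (begin
  n * count n S                 ≤⟨ *-monoˡ-≤ (count n S) half ⟩
  2 * count n g * count n S     ≡⟨ *-assoc 2 (count n g) (count n S) ⟩
  2 * (count n g * count n S)   ≡⟨ cong (2 *_) (∑-count-shifted n g S) ⟨
  2 * ∑[ i < n ] count n (λ r → g (cyc n r (toℕ i)) ∧ S r)
                                ≡⟨ *-distribˡ-sum {n} 2 _ ⟩
  ∑[ i < n ] (2 * count n (λ r → g (cyc n r (toℕ i)) ∧ S r)) ∎)
  where open ≤-Reasoning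

⌊all?⌋-suc : ∀ {t p} {P : Fin (ℕ.suc t) → Set p} (P? : Decidable P) →
  ⌊ all? P? ⌋ ≡ ⌊ P? zero ⌋ ∧ ⌊ all? (P? ∘ suc) ⌋
⌊all?⌋-suc P? = trans (isYes≗does (all? P?))
  (sym (cong₂ _∧_ (isYes≗does (P? zero)) (isYes≗does (all? (P? ∘ suc)))))

∃-shifts-all-good : ∀ {n} → 0 < n → ∀ t {P : Fin t → Fin n → Set} (P? : ∀ j → Decidable (P j)) →
  (∀ j → n ≤ 2 * count n (λ r → ⌊ P? j r ⌋)) →
  ∃ λ (i : Fin t → Fin n) → n ≤ 2 ^ t * count n (λ r → ⌊ all? (λ j → P? j (cyc n r (toℕ (i j)))) ⌋)
∃-shifts-all-good {n} n>0 ℕ.zero P? _ =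
  (λ ()) , ≤-reflexive (sym (trans (+-identityʳ _) (count-true n)))
∃-shifts-all-good {n} n>0 (ℕ.suc t) P? half =
  let i , n≤2^t*|S| = ∃-shifts-all-good n>0 t (P? ∘ suc) (half ∘ suc)
      i₀ , |S|≤2*|S′| = ∃-shift-keeping-half n>0 (λ r → ⌊ P? zero r ⌋) (S i) (half zero)
  in i₀ ∷ i , (begin
    n                                   ≤⟨ n≤2^t*|S| ⟩
    2 ^ t * count n (S i)               ≤⟨ *-monoʳ-≤ (2 ^ t) |S|≤2*|S′| ⟩
    2 ^ t * (2 * count n (S′ i₀ i))     ≡⟨ *-assoc (2 ^ t) 2 _ ⟨
    2 ^ t * 2 * count n (S′ i₀ i)       ≡⟨ cong (_* count n (S′ i₀ i)) (*-comm (2 ^ t) 2) ⟩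
    2 ^ ℕ.suc t * count n (S′ i₀ i)
      ≡⟨ cong (2 ^ ℕ.suc t *_) (count-cong n (λ r →
           sym (⌊all?⌋-suc (λ j → P? j (cyc n r (toℕ ((i₀ ∷ i) j))))))) ⟩
    2 ^ ℕ.suc t * count n (λ r → ⌊ all? (λ j → P? j (cyc n r (toℕ ((i₀ ∷ i) j)))) ⌋) ∎)
  where
  open ≤-Reasoning
  S : (Fin t → Fin n) → Fin n → Bool
  S i r = ⌊ all? (λ j → P? (suc j) (cyc n r (toℕ (i j)))) ⌋
  S′ : Fin n → (Fin t → Fin n) → Fin n → Bool
  S′ i₀ i r = ⌊ P? zero (cyc n r (toℕ i₀)) ⌋ ∧ S i r

proposition2p2 : (k l : ℕ) → (kpos : k > 0) → .{{lpos : NonZero l}} → l ≤ k → (l∣k : l ∣ k)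
    → {E : Set} → (x : Fin l → Fin (k′ k l) → E) → (s : Colour) → (c : E → Colour)
    → (∀ j → k′ k l ≤ 2 * count (k′ k l) (λ t → ⌊ c (x j t) ≟ᶜ s ⌋))
    → ∃ λ (i : Fin l → Fin (k′ k l)) →
        k / l ≤ count (k′ k l) (λ r → ⌊ all? (λ j → c (x j (cyc (k′ k l) r (toℕ (i j)))) ≟ᶜ s) ⌋)
proposition2p2 k l _ l≤k _ x s c majority =
  let i , k′≤2^l*common = ∃-shifts-all-good k′>0 l (λ j r → c (x j r) ≟ᶜ s) majority
  in i , *-cancelˡ-≤ (2 ^ l) {{m^n≢0 2 l}} k′≤2^l*common
  where
  k′>0 : k′ k l > 0
  k′>0 = *-mono-< (m^n>0 2 l) (m≥n⇒m/n>0 l≤k)
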